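{- Let $s$ be a nonempty score sequence of length $n$, written as $s=t_1\oplus t_2\oplus\cdots\oplus t_k$ where $t_1,\dots,t_k$ are its strong summands, and let $j\in\{1,\dots,n-1\}$. Then $s+j$ is a score sequence if and only if there is an index $\ell$ such that $j=|t_\ell|+|t_{\ell+1}|+\cdots+|t_k|$, in which case \[s+j=t_\ell\oplus t_{\ell+1}\oplus\cdots\oplus t_k\oplus t_1\oplus\cdots\oplus t_{\ell-1}.\]
   Context: A score sequence is the nondecreasing sequence of out-degrees of the vertices of a tournament; equivalently (Landau), integers $(s_0,\dots,s_{n-1})$ with $0\le s_0\le\cdots\le s_{n-1}\le n-1$, $s_0+\dots+s_{k-1}\ge\binom{k}{2}$ for $1\le k<n$, and $s_0+\dots+s_{n-1}=\binom n2$. A strong score sequence is a score sequence of length $\ge1$ with $s_0+\dots+s_{k-1}>\binom k2$ for all $1\le k<n$. The direct sum of score sequences $u$ of length $m$ and $v$ is $u\oplus v=uv'$, the concatenation of $u$ with $v'$ obtained by adding $m$ to each entry of $v$. Every score sequence can be written uniquely as a direct sum $t_1\oplus\cdots\oplus t_k$ of nonempty strong score sequences, called its strong summands; $|t|$ denotes the length of $t$. For a sequence $s$ of length $n$ and an integer $j$, $s+j$ is obtained by adding $j$ to each entry, reducing modulo $n$ into $\{0,\dots,n-1\}$, and sorting in nondecreasing order. -}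

module Defs where

open import Data.Nat using (ℕ; zero; suc; _+_; _≤_; _<_; _%_; NonZero)
open import Data.Nat.Properties using (≤-decTotalOrder)
open import Data.Nat.Combinatorics using (_C_)
open import Data.List using (List; []; _∷_; _++_; map; length; take; foldr)
open import Data.Nat.ListAction using (sum)
open import Data.List.Relation.Unary.All using (All)
open import Data.List.Relation.Unary.Linked using (Linked)
open import Data.Product using (_×_)
open import Relation.Binary.PropositionalEquality using (_≡_)
import Data.List.Sort

-- Score sequence (Landau's characterisation, as given in the context):
-- nondecreasing, 0 ≤ s_i ≤ n-1, prefix sums s_0+…+s_{k-1} ≥ C(k,2)
-- for 1 ≤ k < n, and total sum = C(n,2).
IsScore : List ℕ → Set
IsScore s =
  Linked _≤_ s
  × All (λ x → x < length s) s
  × (∀ k → 1 ≤ k → k < length s → k C 2 ≤ sum (take k s))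
  × sum s ≡ length s C 2

IsStrong : List ℕ → Set
IsStrong s =
  IsScore s
  × 1 ≤ length s
  × (∀ k → 1 ≤ k → k < length s → k C 2 < sum (take k s))

_⊕_ : List ℕ → List ℕ → List ℕ
u ⊕ v = u ++ map (λ x → x + length u) v

infixr 5 _⊕_

⨁ : List (List ℕ) → List ℕ
⨁ = foldr _⊕_ []

open Data.List.Sort ≤-decTotalOrder using (sort)

shift : (s : List ℕ) → .{{NonZero (length s)}} → ℕ → List ℕ
shift s j = sort (map (λ x → (x + j) % length s) s)

{-# OPTIONS --safe #-}
-- Write n = p + j. Reducing s + j modulo n sends the entries ≥ p down by p
-- and the entries < p up by j, so s + j is the rotation of s at the first
-- entry ≥ p. Comparing the total of s + j with the total of s shows that it
-- can only be a score sequence if exactly p entries of s are < p; the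
-- Landau inequality for s + j at j then makes the prefix inequality of s at
-- p an equality, and in a direct sum of strong sequences this happens
-- precisely at the boundaries between summands. Conversely, rotating a
-- direct sum u ⊕ v by |v| yields v ⊕ u, which is again a score sequence.
module Submission where

open import Defs
open import Data.Nat
open import Data.Nat.Properties
open import Data.Nat.Combinatorics using (_C_; nCk+nC[k+1]≡[n+1]C[k+1]; nC1≡n)
open import Data.Nat.DivMod using ([m+n]%n≡m%n; m<n⇒m%n≡m)
open import Data.Nat.ListAction using (sum)
open import Data.Nat.ListAction.Properties using (sum-++)
open import Data.Nat.Tactic.RingSolver using (solve-∀)
open import Data.List using (List; []; _∷_; _++_; map; length; take; drop)
open import Data.List.Properties
  using ( length-++; length-map; map-++; map-∘; map-cong; map-cong-local; map-id; map-id-local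
        ; ++-assoc; take-map; take-all; take++drop≡id)
open import Data.List.Relation.Unary.All as All using (All; []; _∷_)
import Data.List.Relation.Unary.All.Properties as Allₚ
open import Data.List.Relation.Unary.Linked as Linked using (Linked; []; [-]; _∷_)
import Data.List.Relation.Unary.Linked.Properties as Linkedₚ
import Data.List.Relation.Unary.AllPairs.Properties as AllPairs
open import Data.List.Relation.Binary.Permutation.Propositional using (_↭_; ↭-trans; ↭-reflexive; ↭⇒↭ₛ′)
open import Data.List.Relation.Binary.Permutation.Propositional.Properties using (++-comm)
open import Data.List.Relation.Unary.Sorted.TotalOrder.Properties using (↗↭↗⇒≋)
open import Data.List.Relation.Binary.Pointwise using (Pointwise-≡⇒≡)
import Data.List.Sort
open import Data.Product using (_×_; _,_; proj₁; proj₂; ∃-syntax)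
open import Data.Empty using (⊥-elim)
open import Function using (_∘_)
open import Function.Bundles using (_⇔_; mk⇔)
open import Relation.Binary.Definitions using (tri<; tri≈; tri>)
open import Relation.Binary.PropositionalEquality
open import Relation.Nullary using (yes; no)

open Data.List.Sort ≤-decTotalOrder using (sort; sort-↭; sort-↗)

[1+n]C2≡n+nC2 : ∀ n → suc n C 2 ≡ n + n C 2
[1+n]C2≡n+nC2 n = trans (sym (nCk+nC[k+1]≡[n+1]C[k+1] n 1)) (cong (_+ n C 2) (nC1≡n n))

[m+n]C2≡mC2+nC2+m*n : ∀ m n → (m + n) C 2 ≡ m C 2 + n C 2 + m * n
[m+n]C2≡mC2+nC2+m*n zero    n = sym (+-identityʳ (n C 2))
[m+n]C2≡mC2+nC2+m*n (suc m) n = begin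
  suc (m + n) C 2                 ≡⟨ [1+n]C2≡n+nC2 (m + n) ⟩
  m + n + (m + n) C 2             ≡⟨ cong (m + n +_) ([m+n]C2≡mC2+nC2+m*n m n) ⟩
  m + n + (m C 2 + n C 2 + m * n) ≡⟨ regroup m n (m C 2) (n C 2) ⟩
  m + m C 2 + n C 2 + (n + m * n) ≡⟨ cong (λ z → z + n C 2 + (n + m * n)) (sym ([1+n]C2≡n+nC2 m)) ⟩
  suc m C 2 + n C 2 + suc m * n   ∎
  where
  open ≡-Reasoning
  regroup : ∀ m n a b → m + n + (a + b + m * n) ≡ m + a + b + (n + m * n)
  regroup = solve-∀

cross-balanced⇒≡ : ∀ {a b p j} → a + b ≡ p + j → j * a ≡ p * b → 1 ≤ j → 1 ≤ p → a ≡ p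
cross-balanced⇒≡ {a} {b} {p} {j} a+b≡p+j ja≡pb 1≤j 1≤p with <-cmp a p
... | tri≈ _ a≡p _ = a≡p
... | tri< a<p _ _ = ⊥-elim (<-irrefl ja≡pb (begin-strict
  j * a <⟨ *-monoʳ-< j {{>-nonZero 1≤j}} a<p ⟩
  j * p ≡⟨ *-comm j p ⟩
  p * j <⟨ *-monoʳ-< p {{>-nonZero 1≤p}} (+-cancelˡ-< a j b (begin-strict
              a + j <⟨ +-monoˡ-< j a<p ⟩
              p + j ≡⟨ a+b≡p+j ⟨
              a + b ∎)) ⟩
  p * b ∎))
  where open ≤-Reasoning
... | tri> _ _ p<a = ⊥-elim (<-irrefl (sym ja≡pb) (begin-strict
  p * b <⟨ *-monoʳ-< p {{>-nonZero 1≤p}} (+-cancelˡ-< p b j (begin-strict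
              p + b <⟨ +-monoˡ-< b p<a ⟩
              a + b ≡⟨ a+b≡p+j ⟩
              p + j ∎)) ⟩
  p * j ≡⟨ *-comm p j ⟩
  j * p <⟨ *-monoʳ-< j {{>-nonZero 1≤j}} p<a ⟩
  j * a ∎))
  where open ≤-Reasoning

sum-map-+ : ∀ m xs → sum (map (_+ m) xs) ≡ sum xs + m * length xs
sum-map-+ m []       = sym (*-zeroʳ m)
sum-map-+ m (x ∷ xs) = begin
  x + m + sum (map (_+ m) xs)       ≡⟨ cong (x + m +_) (sum-map-+ m xs) ⟩
  x + m + (sum xs + m * length xs)  ≡⟨ regroup x m (sum xs) (length xs) ⟩
  x + sum xs + m * suc (length xs)  ∎
  where
  open ≡-Reasoning
  regroup : ∀ x m s l → x + m + (s + m * l) ≡ x + s + m * suc l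
  regroup = solve-∀

sum-map-∸ : ∀ {p ys} → All (p ≤_) ys → sum ys ≡ sum (map (_∸ p) ys) + p * length ys
sum-map-∸ {p} {ys} p≤ys = begin
  sum ys                                            ≡⟨ cong sum (map-id-local (All.map m∸n+n≡m p≤ys)) ⟨
  sum (map ((_+ p) ∘ (_∸ p)) ys)                    ≡⟨ cong sum (map-∘ ys) ⟩
  sum (map (_+ p) (map (_∸ p) ys))                  ≡⟨ sum-map-+ p (map (_∸ p) ys) ⟩
  sum (map (_∸ p) ys) + p * length (map (_∸ p) ys)  ≡⟨ cong (λ l → sum (map (_∸ p) ys) + p * l) (length-map _ ys) ⟩
  sum (map (_∸ p) ys) + p * length ys               ∎
  where open ≡-Reasoning

take-++ˡ : ∀ {A : Set} k (u w : List A) → k ≤ length u → take k (u ++ w) ≡ take k u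
take-++ˡ zero    u       w _         = refl
take-++ˡ (suc k) (x ∷ u) w (s≤s k≤u) = cong (x ∷_) (take-++ˡ k u w k≤u)

take-length-++ : ∀ {A : Set} (u w : List A) r → take (length u + r) (u ++ w) ≡ u ++ take r w
take-length-++ []      w r = refl
take-length-++ (x ∷ u) w r = cong (x ∷_) (take-length-++ u w r)

take-length-++-≡ : ∀ {A : Set} k (u w : List A) → length u ≡ k → take k (u ++ w) ≡ u
take-length-++-≡ k u w refl = trans (take-++ˡ k u w ≤-refl) (take-all k u ≤-refl)

length-take-≤ : ∀ {A : Set} k (xs : List A) → k ≤ length xs → length (take k xs) ≡ k
length-take-≤ zero    xs       _          = refl
length-take-≤ (suc k) (x ∷ xs) (s≤s k≤xs) = cong suc (length-take-≤ k xs k≤xs)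

linked-++ : ∀ {m xs ys} → Linked _≤_ xs → Linked _≤_ ys → All (_< m) xs → All (m ≤_) ys →
            Linked _≤_ (xs ++ ys)
linked-++ []            ys↗ _                 _           = ys↗
linked-++ [-]           []  _                 _           = [-]
linked-++ [-]           ys↗ (x<m ∷ [])        (m≤y ∷ _)   = ≤-trans (<⇒≤ x<m) m≤y ∷ ys↗
linked-++ (x≤x′ ∷ xs↗)  ys↗ (_ ∷ xs<m)        m≤ys        = x≤x′ ∷ linked-++ xs↗ ys↗ xs<m m≤ys

linked-map : ∀ {f : ℕ → ℕ} → (∀ {a b} → a ≤ b → f a ≤ f b) →
             ∀ {xs} → Linked _≤_ xs → Linked _≤_ (map f xs)
linked-map mono = Linkedₚ.map⁺ ∘ Linked.map mono

linked-take : ∀ k {xs} → Linked _≤_ xs → Linked _≤_ (take k xs)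
linked-take k = Linkedₚ.AllPairs⇒Linked ∘ AllPairs.take⁺ k ∘ Linkedₚ.Linked⇒AllPairs ≤-trans

linked-drop : ∀ k {xs} → Linked _≤_ xs → Linked _≤_ (drop k xs)
linked-drop k = Linkedₚ.AllPairs⇒Linked ∘ AllPairs.drop⁺ k ∘ Linkedₚ.Linked⇒AllPairs ≤-trans

sorted-split : ∀ p {s} → Linked _≤_ s → ∃[ a ] (All (_< p) (take a s) × All (p ≤_) (drop a s))
sorted-split p {[]}    _ = 0 , [] , []
sorted-split p {x ∷ s} s↗ with x <? p
... | yes x<p = let a , below , above = sorted-split p (Linked.tail s↗) in suc a , x<p ∷ below , above
... | no  x≮p = 0 , [] , Linkedₚ.Linked⇒All ≤-trans (≮⇒≥ x≮p) s↗

sort-unique : ∀ {xs ys} → Linked _≤_ ys → xs ↭ ys → sort xs ≡ ys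
sort-unique {xs} ys↗ xs↭ys =
  Pointwise-≡⇒≡ (↗↭↗⇒≋ ≤-totalOrder (sort-↗ xs) ys↗
    (↭⇒↭ₛ′ isEquivalence (↭-trans (sort-↭ xs) xs↭ys)))

module _ {s : List ℕ} (s-score : IsScore s) where
  score-sorted : Linked _≤_ s
  score-sorted = proj₁ s-score

  score-bounded : All (_< length s) s
  score-bounded = proj₁ (proj₂ s-score)

  score-landau : ∀ k → 1 ≤ k → k < length s → k C 2 ≤ sum (take k s)
  score-landau = proj₁ (proj₂ (proj₂ s-score))

  score-total : sum s ≡ length s C 2
  score-total = proj₂ (proj₂ (proj₂ s-score))

length-⊕ : ∀ u v → length (u ⊕ v) ≡ length u + length v
length-⊕ u v = trans (length-++ u) (cong (length u +_) (length-map _ v))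

⊕-identityˡ : ∀ v → [] ⊕ v ≡ v
⊕-identityˡ v = trans (map-cong +-identityʳ v) (map-id v)

⊕-assoc : ∀ u v w → (u ⊕ v) ⊕ w ≡ u ⊕ (v ⊕ w)
⊕-assoc u v w = begin
  (u ++ map (_+ length u) v) ++ map (_+ length (u ⊕ v)) w
    ≡⟨ ++-assoc u _ _ ⟩
  u ++ (map (_+ length u) v ++ map (_+ length (u ⊕ v)) w)
    ≡⟨ cong (λ w′ → u ++ (map (_+ length u) v ++ w′)) (trans (map-cong offsets-add w) (map-∘ w)) ⟩
  u ++ (map (_+ length u) v ++ map (_+ length u) (map (_+ length v) w))
    ≡⟨ cong (u ++_) (map-++ _ v _) ⟨
  u ⊕ (v ⊕ w) ∎
  where
  open ≡-Reasoning
  offsets-add : ∀ x → x + length (u ⊕ v) ≡ x + length v + length u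
  offsets-add x = begin
    x + length (u ⊕ v)        ≡⟨ cong (x +_) (trans (length-⊕ u v) (+-comm (length u) (length v))) ⟩
    x + (length v + length u) ≡⟨ +-assoc x _ _ ⟨
    x + length v + length u   ∎

⨁-++ : ∀ xs ys → ⨁ (xs ++ ys) ≡ ⨁ xs ⊕ ⨁ ys
⨁-++ []       ys = sym (⊕-identityˡ (⨁ ys))
⨁-++ (x ∷ xs) ys = trans (cong (x ⊕_) (⨁-++ xs ys)) (sym (⊕-assoc x (⨁ xs) (⨁ ys)))

length-⨁ : ∀ ts → length (⨁ ts) ≡ sum (map length ts)
length-⨁ []       = refl
length-⨁ (t ∷ ts) = trans (length-⊕ t (⨁ ts)) (cong (length t +_) (length-⨁ ts))

-- Both sides exceed their Landau bound by the same amount: the u-block is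
-- tight, and shifting by length u adds exactly the cross term of C(m + r, 2).
prefix-sum-⊕ : ∀ u v r → sum u ≡ length u C 2 → r ≤ length v →
               sum (take (length u + r) (u ⊕ v)) + r C 2 ≡ (length u + r) C 2 + sum (take r v)
prefix-sum-⊕ u v r u-total r≤v = begin
  sum (take (m + r) (u ⊕ v)) + r C 2                 ≡⟨ cong (λ z → sum z + r C 2) (take-length-++ u _ r) ⟩
  sum (u ++ take r (map (_+ m) v)) + r C 2           ≡⟨ cong (_+ r C 2) (sum-++ u _) ⟩
  sum u + sum (take r (map (_+ m) v)) + r C 2        ≡⟨ cong (λ z → sum u + sum z + r C 2) (take-map r v) ⟩
  sum u + sum (map (_+ m) (take r v)) + r C 2        ≡⟨ cong (λ z → sum u + z + r C 2) (sum-map-+ m (take r v)) ⟩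
  sum u + (sum (take r v) + m * length (take r v)) + r C 2
    ≡⟨ cong₂ (λ a l → a + (sum (take r v) + m * l) + r C 2) u-total (length-take-≤ r v r≤v) ⟩
  m C 2 + (sum (take r v) + m * r) + r C 2           ≡⟨ regroup (m C 2) (sum (take r v)) (m * r) (r C 2) ⟩
  m C 2 + r C 2 + m * r + sum (take r v)             ≡⟨ cong (_+ sum (take r v)) ([m+n]C2≡mC2+nC2+m*n m r) ⟨
  (m + r) C 2 + sum (take r v)                       ∎
  where
  open ≡-Reasoning
  m = length u
  regroup : ∀ a b c d → a + (b + c) + d ≡ a + d + c + b
  regroup = solve-∀

prefix-⊕-≥ : ∀ u v r → sum u ≡ length u C 2 → r ≤ length v → r C 2 ≤ sum (take r v) →
             (length u + r) C 2 ≤ sum (take (length u + r) (u ⊕ v))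
prefix-⊕-≥ u v r u-total r≤v v-prefix = +-cancelʳ-≤ (r C 2) _ _ (begin
  (length u + r) C 2 + r C 2              ≤⟨ +-monoʳ-≤ _ v-prefix ⟩
  (length u + r) C 2 + sum (take r v)     ≡⟨ prefix-sum-⊕ u v r u-total r≤v ⟨
  sum (take (length u + r) (u ⊕ v)) + r C 2 ∎)
  where open ≤-Reasoning

prefix-⊕-≤ : ∀ u v r → sum u ≡ length u C 2 → r ≤ length v →
             sum (take (length u + r) (u ⊕ v)) ≤ (length u + r) C 2 → sum (take r v) ≤ r C 2
prefix-⊕-≤ u v r u-total r≤v uv-prefix = +-cancelˡ-≤ ((length u + r) C 2) _ _ (begin
  (length u + r) C 2 + sum (take r v)        ≡⟨ prefix-sum-⊕ u v r u-total r≤v ⟨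
  sum (take (length u + r) (u ⊕ v)) + r C 2  ≤⟨ +-monoˡ-≤ _ uv-prefix ⟩
  (length u + r) C 2 + r C 2                 ∎)
  where open ≤-Reasoning

module _ {u v : List ℕ} (u-score : IsScore u) (v-score : IsScore v) where
  private
    m = length u
    l = length v

  sorted-⊕ : Linked _≤_ (u ⊕ v)
  sorted-⊕ = linked-++ (score-sorted u-score) (linked-map (+-monoˡ-≤ m) (score-sorted v-score)) (score-bounded u-score)
               (Allₚ.map⁺ (All.universal (m≤n+m m) v))

  bounded-⊕ : All (_< length (u ⊕ v)) (u ⊕ v)
  bounded-⊕ = subst (λ n → All (_< n) (u ⊕ v)) (sym (length-⊕ u v))
    (Allₚ.++⁺ (All.map (λ x<m → <-≤-trans x<m (m≤m+n m l)) (score-bounded u-score))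
              (Allₚ.map⁺ (All.map (λ {x} x<l → subst (x + m <_) (+-comm l m) (+-monoˡ-< m x<l))
                                  (score-bounded v-score))))

  landau-⊕ : ∀ k → 1 ≤ k → k < length (u ⊕ v) → k C 2 ≤ sum (take k (u ⊕ v))
  landau-⊕ k 1≤k k<n with <-cmp k m
  ... | tri< k<m _ _ = subst (λ w → k C 2 ≤ sum w) (sym (take-++ˡ k u _ (<⇒≤ k<m)))
                             (score-landau u-score k 1≤k k<m)
  ... | tri≈ _ k≡m _ = subst (λ w → k C 2 ≤ sum w) (sym (take-length-++-≡ k u _ (sym k≡m)))
                             (≤-reflexive (trans (cong (_C 2) k≡m) (sym (score-total u-score))))
  ... | tri> _ _ m<k = subst (λ k → k C 2 ≤ sum (take k (u ⊕ v))) m+r≡k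
          (prefix-⊕-≥ u v r (score-total u-score) (<⇒≤ r<l)
             (score-landau v-score r (m<n⇒0<n∸m m<k) r<l))
    where
    r = k ∸ m
    m+r≡k : m + r ≡ k
    m+r≡k = m+[n∸m]≡n (<⇒≤ m<k)
    r<l : r < l
    r<l = +-cancelˡ-< m r l (subst₂ _<_ (sym m+r≡k) (length-⊕ u v) k<n)

  total-⊕ : sum (u ⊕ v) ≡ length (u ⊕ v) C 2
  total-⊕ = +-cancelʳ-≡ (l C 2) _ _ (begin
    sum (u ⊕ v) + l C 2
      ≡⟨ cong (λ w → sum w + l C 2) (take-all (m + l) (u ⊕ v) (≤-reflexive (length-⊕ u v))) ⟨
    sum (take (m + l) (u ⊕ v)) + l C 2
      ≡⟨ prefix-sum-⊕ u v l (score-total u-score) ≤-refl ⟩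
    (m + l) C 2 + sum (take l v)
      ≡⟨ cong ((m + l) C 2 +_) (trans (cong sum (take-all l v ≤-refl)) (score-total v-score)) ⟩
    (m + l) C 2 + l C 2
      ≡⟨ cong (λ n → n C 2 + l C 2) (length-⊕ u v) ⟨
    length (u ⊕ v) C 2 + l C 2 ∎)
    where open ≡-Reasoning

  IsScore-⊕ : IsScore (u ⊕ v)
  IsScore-⊕ = sorted-⊕ , bounded-⊕ , landau-⊕ , total-⊕

IsScore-⨁ : ∀ {ts} → All IsScore ts → IsScore (⨁ ts)
IsScore-⨁ []                   = [] , [] , (λ _ _ ()) , refl
IsScore-⨁ (t-score ∷ ts-score) = IsScore-⊕ t-score (IsScore-⨁ ts-score)

shift-split : ∀ {p j} s X Y .{{_ : NonZero (length s)}} → s ≡ X ++ Y → p + j ≡ length s →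
              Linked _≤_ X → Linked _≤_ Y → All (_< p) X → All (p ≤_) Y → All (_< length s) Y →
              shift s j ≡ map (_∸ p) Y ++ map (_+ j) X
shift-split {p} {j} .(X ++ Y) X Y refl p+j≡n X↗ Y↗ X<p p≤Y Y<n =
  sort-unique sorted (↭-trans (↭-reflexive reduce) (++-comm (map (_+ j) X) _))
  where
  n = length (X ++ Y)
  wrap-low : ∀ {x} → x < p → (x + j) % n ≡ x + j
  wrap-low {x} x<p = m<n⇒m%n≡m (subst (x + j <_) p+j≡n (+-monoˡ-< j x<p))
  wrap-high : ∀ {y} → p ≤ y × y < n → (y + j) % n ≡ y ∸ p
  wrap-high {y} (p≤y , y<n) = begin
    (y + j) % n         ≡⟨ cong (λ z → (z + j) % n) (m∸n+n≡m p≤y) ⟨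
    (y ∸ p + p + j) % n ≡⟨ cong (_% n) (trans (+-assoc (y ∸ p) p j) (cong (y ∸ p +_) p+j≡n)) ⟩
    (y ∸ p + n) % n     ≡⟨ [m+n]%n≡m%n (y ∸ p) n ⟩
    (y ∸ p) % n         ≡⟨ m<n⇒m%n≡m (≤-<-trans (m∸n≤m y p) y<n) ⟩
    y ∸ p               ∎
    where open ≡-Reasoning
  reduce : map (λ x → (x + j) % n) (X ++ Y) ≡ map (_+ j) X ++ map (_∸ p) Y
  reduce = trans (map-++ _ X Y)
    (cong₂ _++_ (map-cong-local (All.map wrap-low X<p)) (map-cong-local (All.zipWith wrap-high (p≤Y , Y<n))))
  below-j : ∀ {y} → p ≤ y × y < n → y ∸ p < j
  below-j {y} (p≤y , y<n) = +-cancelˡ-< p (y ∸ p) j (subst₂ _<_ (sym (m+[n∸m]≡n p≤y)) (sym p+j≡n) y<n)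
  sorted : Linked _≤_ (map (_∸ p) Y ++ map (_+ j) X)
  sorted = linked-++ (linked-map (∸-monoˡ-≤ p) Y↗) (linked-map (+-monoˡ-≤ j) X↗)
             (Allₚ.map⁺ (All.zipWith below-j (p≤Y , Y<n))) (Allₚ.map⁺ (All.universal (m≤n+m j) X))

shift-⊕ : ∀ {u v} → IsScore u → IsScore v → ∀ s .{{_ : NonZero (length s)}} → s ≡ u ⊕ v →
          shift s (length v) ≡ v ⊕ u
shift-⊕ {u} {v} u-score v-score s refl = begin
  shift (u ⊕ v) (length v)                     ≡⟨ shift-split (u ⊕ v) u v′ refl (sym (length-⊕ u v))
                                                    (score-sorted u-score) v′-sorted (score-bounded u-score)
                                                    (Allₚ.map⁺ (All.universal (m≤n+m (length u)) v)) v′-bounded ⟩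
  map (_∸ length u) v′ ++ map (_+ length v) u  ≡⟨ cong (_++ map (_+ length v) u) unshift ⟩
  v ⊕ u                                        ∎
  where
  open ≡-Reasoning
  v′ = map (_+ length u) v
  v′-sorted : Linked _≤_ v′
  v′-sorted = linked-map (+-monoˡ-≤ (length u)) (score-sorted v-score)
  v′-bounded : All (_< length (u ⊕ v)) v′
  v′-bounded = Allₚ.++⁻ʳ u (score-bounded (IsScore-⊕ u-score v-score))
  unshift : map (_∸ length u) v′ ≡ v
  unshift = trans (sym (map-∘ v)) (trans (map-cong (λ x → m+n∸n≡m x (length u)) v) (map-id v))

sum-++-lowered : ∀ {p} X Y → All (p ≤_) Y → sum (X ++ Y) ≡ sum X + sum (map (_∸ p) Y) + p * length Y
sum-++-lowered {p} X Y p≤Y = begin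
  sum (X ++ Y)                                 ≡⟨ sum-++ X Y ⟩
  sum X + sum Y                                ≡⟨ cong (sum X +_) (sum-map-∸ p≤Y) ⟩
  sum X + (sum (map (_∸ p) Y) + p * length Y)  ≡⟨ +-assoc (sum X) _ _ ⟨
  sum X + sum (map (_∸ p) Y) + p * length Y    ∎
  where open ≡-Reasoning

sum-rotated : ∀ {p j} X Y → sum (map (_∸ p) Y ++ map (_+ j) X) ≡ sum X + sum (map (_∸ p) Y) + j * length X
sum-rotated {p} {j} X Y = begin
  sum (Y′ ++ map (_+ j) X)         ≡⟨ sum-++ Y′ _ ⟩
  sum Y′ + sum (map (_+ j) X)      ≡⟨ cong (sum Y′ +_) (sum-map-+ j X) ⟩
  sum Y′ + (sum X + j * length X)  ≡⟨ regroup (sum Y′) (sum X) (j * length X) ⟩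
  sum X + sum Y′ + j * length X    ∎
  where
  open ≡-Reasoning
  Y′ = map (_∸ p) Y
  regroup : ∀ a b c → a + (b + c) ≡ b + a + c
  regroup = solve-∀

length-rotated : ∀ {f g : ℕ → ℕ} X Y → length (map f Y ++ map g X) ≡ length (X ++ Y)
length-rotated {f} {g} X Y = begin
  length (map f Y ++ map g X)        ≡⟨ length-++ (map f Y) ⟩
  length (map f Y) + length (map g X) ≡⟨ cong₂ _+_ (length-map f Y) (length-map g X) ⟩
  length Y + length X                ≡⟨ +-comm (length Y) (length X) ⟩
  length X + length Y                ≡⟨ length-++ X ⟨
  length (X ++ Y)                    ∎
  where open ≡-Reasoning

-- Both sequences have total C(p + j, 2), which forces j |X| = p |Y|.
rotated-isScore⇒length≡ : ∀ {p j} X Y → p + j ≡ length (X ++ Y) → 1 ≤ p → 1 ≤ j → All (p ≤_) Y →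
                          sum (X ++ Y) ≡ length (X ++ Y) C 2 → IsScore (map (_∸ p) Y ++ map (_+ j) X) →
                          length X ≡ p
rotated-isScore⇒length≡ {p} {j} X Y p+j≡n 1≤p 1≤j p≤Y XY-total rotated-score =
  cross-balanced⇒≡ (trans (sym (length-++ X)) (sym p+j≡n)) (+-cancelˡ-≡ (sum X + sum Y′) _ _ (begin
    sum X + sum Y′ + j * length X  ≡⟨ sum-rotated {p} {j} X Y ⟨
    sum (Y′ ++ X′)                 ≡⟨ score-total rotated-score ⟩
    length (Y′ ++ X′) C 2          ≡⟨ cong (_C 2) (length-rotated X Y) ⟩
    length (X ++ Y) C 2            ≡⟨ XY-total ⟨
    sum (X ++ Y)                   ≡⟨ sum-++-lowered X Y p≤Y ⟩
    sum X + sum Y′ + p * length Y  ∎)) 1≤j 1≤p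
  where
  open ≡-Reasoning
  Y′ = map (_∸ p) Y
  X′ = map (_+ j) X

shift-isScore⇒tight : ∀ s .{{_ : NonZero (length s)}} {p j} → p + j ≡ length s → 1 ≤ p → 1 ≤ j →
                      IsScore s → IsScore (shift s j) → sum (take p s) ≤ p C 2
shift-isScore⇒tight s {p} {j} p+j≡n 1≤p 1≤j s-score shifted-score
  with a , X<p , p≤Y ← sorted-split p (score-sorted s-score) = +-cancelʳ-≤ (j C 2) _ _ (begin
    sum (take p s) + j C 2  ≡⟨ cong (λ w → sum w + j C 2) (trans (cong (take p) s≡X++Y) prefix-is-X) ⟩
    sum X + j C 2           ≤⟨ +-monoʳ-≤ (sum X) Y′-landau ⟩
    sum X + sum Y′          ≡⟨ +-cancelʳ-≡ (p * j) _ _ s-total ⟩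
    p C 2 + j C 2           ∎)
  where
  open ≤-Reasoning
  X = take a s
  Y = drop a s
  Y′ = map (_∸ p) Y
  X′ = map (_+ j) X
  s≡X++Y : s ≡ X ++ Y
  s≡X++Y = sym (take++drop≡id a s)
  XY-score : IsScore (X ++ Y)
  XY-score = subst IsScore s≡X++Y s-score
  Y′X′-score : IsScore (Y′ ++ X′)
  Y′X′-score = subst IsScore (shift-split s X Y s≡X++Y p+j≡n (linked-take a (score-sorted s-score))
                 (linked-drop a (score-sorted s-score)) X<p p≤Y (Allₚ.drop⁺ a (score-bounded s-score))) shifted-score
  |XY|≡p+j : length (X ++ Y) ≡ p + j
  |XY|≡p+j = trans (cong length (sym s≡X++Y)) (sym p+j≡n)
  |X|≡p : length X ≡ p
  |X|≡p = rotated-isScore⇒length≡ X Y (sym |XY|≡p+j) 1≤p 1≤j p≤Y (score-total XY-score) Y′X′-score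
  prefix-is-X : take p (X ++ Y) ≡ X
  prefix-is-X = take-length-++-≡ p X Y |X|≡p
  |Y|≡j : length Y ≡ j
  |Y|≡j = +-cancelˡ-≡ p _ _ (trans (cong (_+ length Y) (sym |X|≡p)) (trans (sym (length-++ X)) |XY|≡p+j))
  s-total : sum X + sum Y′ + p * j ≡ p C 2 + j C 2 + p * j
  s-total = begin-equality
    sum X + sum Y′ + p * j         ≡⟨ cong (λ b → sum X + sum Y′ + p * b) |Y|≡j ⟨
    sum X + sum Y′ + p * length Y  ≡⟨ sum-++-lowered X Y p≤Y ⟨
    sum (X ++ Y)                   ≡⟨ score-total XY-score ⟩
    length (X ++ Y) C 2            ≡⟨ cong (_C 2) |XY|≡p+j ⟩
    (p + j) C 2                    ≡⟨ [m+n]C2≡mC2+nC2+m*n p j ⟩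
    p C 2 + j C 2 + p * j          ∎
  Y′-landau : j C 2 ≤ sum Y′
  Y′-landau = subst (λ w → j C 2 ≤ sum w) (take-length-++-≡ j Y′ X′ (trans (length-map _ Y) |Y|≡j))
    (score-landau Y′X′-score j 1≤j (subst (j <_) (trans (sym |XY|≡p+j) (sym (length-rotated X Y))) (m<n+m j 1≤p)))

tight-prefix⇒boundary : ∀ {ts} → All IsStrong ts → ∀ {p j} → p + j ≡ length (⨁ ts) → 1 ≤ p → 1 ≤ j →
                        sum (take p (⨁ ts)) ≤ p C 2 → ∃[ ℓ ] (ℓ < length ts × j ≡ sum (map length (drop ℓ ts)))
tight-prefix⇒boundary {[]} [] {suc p} ()
tight-prefix⇒boundary {t ∷ ts} ((t-score , _ , t-strict) ∷ ts-strong) {p} {j} p+j≡n 1≤p 1≤j tight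
  with <-cmp p (length t)
... | tri< p<m _ _ =
  ⊥-elim (<⇒≱ (t-strict p 1≤p p<m) (subst (λ w → sum w ≤ p C 2) (take-++ˡ p t _ (<⇒≤ p<m)) tight))
... | tri≈ _ refl _ = 1 , s≤s (nonempty ts (subst (1 ≤_) j≡|ts| 1≤j)) , j≡|ts|
  where
  j≡|ts| : j ≡ sum (map length ts)
  j≡|ts| = trans (+-cancelˡ-≡ p _ _ (trans p+j≡n (length-⊕ t (⨁ ts)))) (length-⨁ ts)
  nonempty : ∀ (us : List (List ℕ)) → 1 ≤ sum (map length us) → 1 ≤ length us
  nonempty (_ ∷ _) _ = s≤s z≤n
... | tri> _ _ m<p =
  let ℓ , ℓ<ts , j≡ = tight-prefix⇒boundary ts-strong r+j≡|w| (m<n⇒0<n∸m m<p) 1≤j tight-at-r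
  in suc ℓ , s≤s ℓ<ts , j≡
  where
  m = length t
  w = ⨁ ts
  r = p ∸ m
  m+r≡p : m + r ≡ p
  m+r≡p = m+[n∸m]≡n (<⇒≤ m<p)
  r+j≡|w| : r + j ≡ length w
  r+j≡|w| = +-cancelˡ-≡ m _ _
    (trans (sym (+-assoc m r j)) (trans (cong (_+ j) m+r≡p) (trans p+j≡n (length-⊕ t w))))
  tight-at-r : sum (take r w) ≤ r C 2
  tight-at-r = prefix-⊕-≤ t w r (score-total t-score) (subst (r ≤_) r+j≡|w| (m≤m+n r j))
                 (subst (λ k → sum (take k (t ⊕ w)) ≤ k C 2) (sym m+r≡p) tight)

lemma8 : (s : List ℕ) → .{{_ : NonZero (length s)}} → IsScore s →
           (ts : List (List ℕ)) → All IsStrong ts → s ≡ ⨁ ts →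
           (j : ℕ) → 1 ≤ j → j < length s →
           (IsScore (shift s j)
              ⇔ (∃[ ℓ ] (ℓ < length ts × j ≡ sum (map length (drop ℓ ts)))))
           × (∀ ℓ → ℓ < length ts → j ≡ sum (map length (drop ℓ ts)) →
                shift s j ≡ ⨁ (drop ℓ ts ++ take ℓ ts))
lemma8 s s-score ts ts-strong refl j 1≤j j<n = mk⇔ score⇒boundary boundary⇒score , rotation
  where
  ts-score : All IsScore ts
  ts-score = All.map proj₁ ts-strong
  rotation : ∀ ℓ → ℓ < length ts → j ≡ sum (map length (drop ℓ ts)) →
             shift s j ≡ ⨁ (drop ℓ ts ++ take ℓ ts)
  rotation ℓ _ j≡ = begin
    shift s j                         ≡⟨ cong (shift s) (trans j≡ (sym (length-⨁ (drop ℓ ts)))) ⟩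
    shift s (length (⨁ (drop ℓ ts)))  ≡⟨ shift-⊕ (IsScore-⨁ (Allₚ.take⁺ ℓ ts-score))
                                           (IsScore-⨁ (Allₚ.drop⁺ ℓ ts-score)) s
                                           (trans (cong ⨁ (sym (take++drop≡id ℓ ts)))
                                                  (⨁-++ (take ℓ ts) (drop ℓ ts))) ⟩
    ⨁ (drop ℓ ts) ⊕ ⨁ (take ℓ ts)     ≡⟨ ⨁-++ (drop ℓ ts) (take ℓ ts) ⟨
    ⨁ (drop ℓ ts ++ take ℓ ts)        ∎
    where open ≡-Reasoning
  boundary⇒score : ∃[ ℓ ] (ℓ < length ts × j ≡ sum (map length (drop ℓ ts))) → IsScore (shift s j)
  boundary⇒score (ℓ , ℓ<ts , j≡) = subst IsScore (sym (rotation ℓ ℓ<ts j≡))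
    (IsScore-⨁ (Allₚ.++⁺ (Allₚ.drop⁺ ℓ ts-score) (Allₚ.take⁺ ℓ ts-score)))
  score⇒boundary : IsScore (shift s j) → ∃[ ℓ ] (ℓ < length ts × j ≡ sum (map length (drop ℓ ts)))
  score⇒boundary shifted-score = tight-prefix⇒boundary ts-strong p+j≡n (m<n⇒0<n∸m j<n) 1≤j
    (shift-isScore⇒tight s p+j≡n (m<n⇒0<n∸m j<n) 1≤j s-score shifted-score)
    where
    p+j≡n : length s ∸ j + j ≡ length s
    p+j≡n = m∸n+n≡m (<⇒≤ j<n)
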